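{- Let $G=(V(G),\alpha)$ be a tournament with $V(G)=\{1,\dots,n\}$. The following are equivalent: (i) $G$ is self-converse, i.e. $G$ and its converse $G'$ are isomorphic; (ii) $t_{ind}(F,G)=t_{ind}(F',G)$ for every tournament $F$; (iii) $t(F,G)=t(F',G)$ for every digraph $F$; (iv) there exists a bijection $\rho:V(G)\to V(G)$ with $\alpha(i,j)+\alpha(\rho(i),\rho(j))=1$ for all distinct $i,j\in V(G)$.
   Context: A tournament $G=(V(G),\alpha)$ on $V(G)=\{1,\dots,n\}$ is given by $\alpha:V(G)^2\to\{0,1\}$ with $\alpha(u,v)+\alpha(v,u)=1$ for $u\neq v$ and $\alpha(u,u)=0$; its edges are the pairs with $\alpha(u,v)=1$. The converse $G'=(V(G),\alpha')$ has $\alpha'(i,j)=1-\alpha(i,j)$ for $i\ne j$ (all edges reversed); the converse $F'$ of a digraph $F$ is obtained by reversing all edges. Two tournaments are isomorphic if there is a bijection $\rho$ of vertex sets with $\alpha_1(i,j)=\alpha_2(\rho(i),\rho(j))$ for all $i,j$. A digraph $F$ has a finite vertex set and a set of ordered pairs of distinct vertices as edges. For digraphs $F,G$: $t(F,G)=\hom(F,G)/|V(G)|^{|V(F)|}$, where $\hom(F,G)$ is the number of maps $\phi:V(F)\to V(G)$ with $(\phi(i),\phi(j))\in E(G)$ for all $(i,j)\in E(F)$; $t_{ind}(F,G)=\mathrm{ind}(F,G)/(|V(G)|)_{|V(F)|}$, where $(N)_k=N(N-1)\cdots(N-k+1)$ and $\mathrm{ind}(F,G)$ is the number of injective maps $\phi:V(F)\to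 V(G)$ with $(\phi(i),\phi(j))\in E(G)$ iff $(i,j)\in E(F)$. -}

module Defs where

open import Data.Nat using (ℕ; zero; suc; _+_; _∸_; _^_; _≡ᵇ_)
open import Data.Nat.Combinatorics using (_P_)
open import Data.Integer using (+_)
open import Data.Rational using (ℚ; _/_; 0ℚ)
open import Data.Fin using (Fin; zero; suc; _≟_)
open import Data.List using (List; []; _∷_; [_]; map; concatMap)
open import Data.Nat.ListAction using (sum)
open import Data.List using (allFin)
open import Data.Bool using (Bool; true; false; if_then_else_; not; _∧_; _∨_; _xor_)
open import Relation.Binary.PropositionalEquality using (_≡_; _≢_; refl; subst)
open import Relation.Nullary using (¬_; does)
open import Function.Definitions using (Bijective)

record Tournament (n : ℕ) : Set where
  field
    α    : Fin n → Fin n → ℕ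
    diag : ∀ u → α u u ≡ 0
    anti : ∀ u v → u ≢ v → α u v + α v u ≡ 1
open Tournament public

α′ : ∀ {n} → Tournament n → Fin n → Fin n → ℕ
α′ G i j = if does (i ≟ j) then 0 else 1 ∸ α G i j

Isomorphic : ∀ {n} → (Fin n → Fin n → ℕ) → (Fin n → Fin n → ℕ) → Set
Isomorphic {n} α₁ α₂ =
  Data.Product.Σ (Fin n → Fin n) (λ ρ →
     Bijective _≡_ _≡_ ρ Data.Product.× (∀ i j → α₁ i j ≡ α₂ (ρ i) (ρ j)))
  where import Data.Product

SelfConverse : ∀ {n} → Tournament n → Set
SelfConverse G = Isomorphic (α G) (α′ G)

record Digraph (k : ℕ) : Set where
  field
    adj      : Fin k → Fin k → Bool
    loopless : ∀ i → adj i i ≡ false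
open Digraph public

converse : ∀ {k} → Digraph k → Digraph k
converse F = record { adj = λ i j → adj F j i ; loopless = loopless F }

toDigraph : ∀ {n} → Tournament n → Digraph n
toDigraph G = record { adj = λ u v → α G u v ≡ᵇ 1 ; loopless = lp }
  where
  lp : ∀ u → (α G u u ≡ᵇ 1) ≡ false
  lp u rewrite diag G u = refl

allMaps : ∀ k n → List (Fin k → Fin n)
allMaps zero    n = [ (λ ()) ]
allMaps (suc k) n =
  concatMap (λ f → map (λ x → cons x f) (allFin n)) (allMaps k n)
  where
  cons : Fin n → (Fin k → Fin n) → Fin (suc k) → Fin n
  cons x f zero    = x
  cons x f (suc i) = f i

allB : ∀ {k} → (Fin k → Bool) → Bool
allB {k} p = Data.List.foldr _∧_ true (map p (allFin k))
  where import Data.List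

count : ∀ {a} {A : Set a} → (A → Bool) → List A → ℕ
count p xs = sum (map (λ x → if p x then 1 else 0) xs)

isHom : ∀ {k n} → Digraph k → Digraph n → (Fin k → Fin n) → Bool
isHom F G φ = allB (λ i → allB (λ j → not (adj F i j) ∨ adj G (φ i) (φ j)))

isInj : ∀ {k n} → (Fin k → Fin n) → Bool
isInj φ = allB (λ i → allB (λ j → does (i ≟ j) ∨ not (does (φ i ≟ φ j))))

isIndEmb : ∀ {k n} → Digraph k → Digraph n → (Fin k → Fin n) → Bool
isIndEmb F G φ = isInj φ ∧
  allB (λ i → allB (λ j → not (adj G (φ i) (φ j) xor adj F i j)))

hom : ∀ {k n} → Digraph k → Digraph n → ℕ
hom {k} {n} F G = count (isHom F G) (allMaps k n)

ind : ∀ {k n} → Digraph k → Digraph n → ℕ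
ind {k} {n} F G = count (isIndEmb F G) (allMaps k n)

-- a / b as a rational; convention: 0 when b = 0
_÷_ : ℕ → ℕ → ℚ
a ÷ zero  = 0ℚ
a ÷ suc b = (+ a) / suc b

t : ∀ {k n} → Digraph k → Digraph n → ℚ
t {k} {n} F G = hom F G ÷ (n ^ k)

tind : ∀ {k n} → Digraph k → Digraph n → ℚ
tind {k} {n} F G = ind F G ÷ (n P k)

-- A bijection ρ is an isomorphism G ≅ G′ exactly when it reverses every edge,
-- α(ρ i, ρ j) = α(j, i); for a tournament, where α(i, j) + α(j, i) = 1 off the
-- diagonal, this is condition (iv). Composing with such a ρ turns homomorphisms and
-- induced embeddings of F into G into those of F′, and φ ↦ ρ ∘ φ permutes all maps
-- V(F) → V(G), so both densities agree. Conversely, for F = G the identity makes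
-- hom(G, G) and ind(G, G) nonzero, hence so are hom(G′, G) and ind(G′, G). A
-- homomorphism G′ → G between tournaments is injective, as distinct vertices are
-- adjacent, so it is a bijection of V(G) reversing every edge.

module Submission where

open import Defs
open import Data.Nat using (ℕ; zero; suc; _+_; _≤_; _∸_; _^_; _≡ᵇ_; NonZero)
open import Data.Nat.Properties
  using (+-0-commutativeMonoid; ≤-reflexive; ≤-trans; m≤m+n; m≤n+m; <-irrefl; m<n⇒n≢0;
         +-cancelˡ-≡; m+n∸m≡n; suc-injective; *-cancelʳ-≡; ≡ᵇ⇒≡; ≡⇒≡ᵇ; m^n≢0; _!≢0;
         module ≤-Reasoning)
open import Data.Nat.Combinatorics using (_P_; nPn≡n!)
open import Data.Nat.ListAction using (sum)
open import Data.Nat.ListAction.Properties using (sum-++)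
open import Data.Fin using (Fin; zero; suc; _≟_; punchOut)
open import Data.Fin.Properties using (any?; punchOut-injective; injective⇒≤)
open import Data.Vec.Functional using () renaming (_∷_ to _∷ᶠ_)
open import Data.List using (List; []; _∷_; _++_; map; concatMap; tabulate; allFin)
open import Data.List.Properties using (map-cong; map-∘; map-++; map-tabulate)
open import Data.List.Relation.Unary.All using (lookup)
open import Data.List.Relation.Unary.All.Properties using (all⁺; all⁻; tabulate⁺)
open import Data.List.Membership.Propositional.Properties using (∈-allFin)
open import Data.Bool using (Bool; true; false; T; if_then_else_; not; _∧_; _∨_; _xor_)
open import Data.Bool.ListAction using (and)
open import Data.Bool.Properties using (T-∧; T-≡; ∨-inverseˡ; ∨-inverseʳ; xor-same)
open import Data.Product using (Σ; _×_; _,_; proj₁; proj₂; ∃)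
open import Data.Sum using (_⊎_; inj₁; inj₂)
open import Data.Rational.Properties using (normalize-injective-≃)
open import Function.Base using (_∘_; id)
open import Function.Bundles using (_⇔_; mk⇔; mk⤖; Equivalence)
open import Function.Construct.Composition using (_⇔-∘_)
open import Function.Definitions using (Bijective; Injective)
open import Function.Properties.Bijection using (⤖⇒↔)
open import Relation.Binary.PropositionalEquality
  using (_≡_; _≢_; _≗_; refl; sym; trans; cong; cong₂; subst; module ≡-Reasoning)
open import Relation.Nullary using (yes; no; does; contradiction)
open import Relation.Nullary.Decidable using (dec-true; dec-false)
open import Algebra.Properties.CommutativeMonoid.Sum +-0-commutativeMonoid
  using (sum-permute; sum-cong-≗) renaming (sum to ∑)

injective⇒surjective : ∀ {n} {f : Fin n → Fin n} → Injective _≡_ _≡_ f →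
                       ∀ y → ∃ λ x → f x ≡ y
injective⇒surjective {suc m} {f} f-inj y with any? (λ x → f x ≟ y)
... | yes hit = hit
... | no miss = contradiction (injective⇒≤ punchOut∘f-inj) (<-irrefl refl)
  where
  misses : ∀ x → y ≢ f x
  misses x y≡fx = miss (x , sym y≡fx)
  punchOut∘f-inj : Injective _≡_ _≡_ (λ x → punchOut (misses x))
  punchOut∘f-inj = f-inj ∘ punchOut-injective (misses _) (misses _)

injective⇒bijective : ∀ {n} {f : Fin n → Fin n} → Injective _≡_ _≡_ f → Bijective _≡_ _≡_ f
injective⇒bijective f-inj = f-inj , λ y →
  let x , fx≡y = injective⇒surjective f-inj y in x , λ { refl → fx≡y }

∑-bijective : ∀ {n} {ρ : Fin n → Fin n} → Bijective _≡_ _≡_ ρ →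
              (g : Fin n → ℕ) → ∑ (g ∘ ρ) ≡ ∑ g
∑-bijective ρ-bij g = sym (sum-permute g (⤖⇒↔ (mk⤖ ρ-bij)))

≤-∑ : ∀ {n} (g : Fin n → ℕ) i → g i ≤ ∑ g
≤-∑ g zero    = m≤m+n _ _
≤-∑ g (suc i) = ≤-trans (≤-∑ (g ∘ suc) i) (m≤n+m _ _)

sum-tabulate : ∀ {n} (g : Fin n → ℕ) → sum (tabulate g) ≡ ∑ g
sum-tabulate {zero}  g = refl
sum-tabulate {suc n} g = cong (g zero +_) (sum-tabulate (g ∘ suc))

sum-map-allFin : ∀ {n} (g : Fin n → ℕ) → sum (map g (allFin n)) ≡ ∑ g
sum-map-allFin {n} g = trans (cong sum (map-tabulate id g)) (sum-tabulate g)

sum-map-cong : ∀ {A : Set} {g h : A → ℕ} → g ≗ h → ∀ xs → sum (map g xs) ≡ sum (map h xs)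
sum-map-cong g≗h xs = cong sum (map-cong g≗h xs)

sum-map-concatMap : ∀ {A B : Set} (h : B → ℕ) (f : A → List B) xs →
                    sum (map h (concatMap f xs)) ≡ sum (map (λ x → sum (map h (f x))) xs)
sum-map-concatMap h f []       = refl
sum-map-concatMap h f (x ∷ xs) = begin
  sum (map h (f x ++ concatMap f xs))
    ≡⟨ cong sum (map-++ h (f x) (concatMap f xs)) ⟩
  sum (map h (f x) ++ map h (concatMap f xs))
    ≡⟨ sum-++ (map h (f x)) (map h (concatMap f xs)) ⟩
  sum (map h (f x)) + sum (map h (concatMap f xs))
    ≡⟨ cong (sum (map h (f x)) +_) (sum-map-concatMap h f xs) ⟩
  sum (map h (f x)) + sum (map (λ x → sum (map h (f x))) xs) ∎
  where open ≡-Reasoning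

Extensional : ∀ {k n} {B : Set} → ((Fin k → Fin n) → B) → Set
Extensional h = ∀ {f g} → f ≗ g → h f ≡ h g

sumOutHead : ∀ {k n} → ((Fin (suc k) → Fin n) → ℕ) → (Fin k → Fin n) → ℕ
sumOutHead h f = ∑ (λ x → h (x ∷ᶠ f))

sumOutHead-extensional : ∀ {k n} {h : (Fin (suc k) → Fin n) → ℕ} →
                         Extensional h → Extensional (sumOutHead h)
sumOutHead-extensional {h = h} h-ext {f} {g} f≗g =
  sum-cong-≗ {x = λ a → h (a ∷ᶠ f)} {y = λ a → h (a ∷ᶠ g)}
    (λ a → h-ext λ { zero → refl ; (suc i) → f≗g i })

sum-allMaps-suc : ∀ {k n} (h : (Fin (suc k) → Fin n) → ℕ) → Extensional h →
  sum (map h (allMaps (suc k) n)) ≡ sum (map (sumOutHead h) (allMaps k n))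
sum-allMaps-suc {k} {n} h h-ext =
  trans (sum-map-concatMap h _ (allMaps k n)) (sum-map-cong sum-over-heads (allMaps k n))
  where
  -- allMaps builds its maps with a cons local to Defs, which agrees with _∷ᶠ_ only pointwise.
  sum-over-heads : ∀ f → sum (map h (map (λ x → _) (allFin n))) ≡ sumOutHead h f
  sum-over-heads f =
    trans (cong sum (sym (map-∘ (allFin n))))
      (trans (sum-map-cong (λ x → h-ext λ { zero → refl ; (suc i) → refl }) (allFin n))
        (sum-map-allFin (λ x → h (x ∷ᶠ f))))

sum-allMaps-∘-bijective : ∀ k {n} {ρ : Fin n → Fin n} → Bijective _≡_ _≡_ ρ →
  (h : (Fin k → Fin n) → ℕ) → Extensional h →
  sum (map h (allMaps k n)) ≡ sum (map (h ∘ (ρ ∘_)) (allMaps k n))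
sum-allMaps-∘-bijective zero    ρ-bij h h-ext = cong (_+ 0) (h-ext λ ())
sum-allMaps-∘-bijective (suc k) {n} {ρ} ρ-bij h h-ext = begin
  sum (map h (allMaps (suc k) n))
    ≡⟨ sum-allMaps-suc h h-ext ⟩
  sum (map (sumOutHead h) (allMaps k n))
    ≡⟨ sum-allMaps-∘-bijective k ρ-bij (sumOutHead h) (sumOutHead-extensional h-ext) ⟩
  sum (map (sumOutHead h ∘ (ρ ∘_)) (allMaps k n))
    ≡⟨ sum-map-cong sumOutHead-∘ (allMaps k n) ⟩
  sum (map (sumOutHead (h ∘ (ρ ∘_))) (allMaps k n))
    ≡⟨ sum-allMaps-suc (h ∘ (ρ ∘_)) (λ f≗g → h-ext (cong ρ ∘ f≗g)) ⟨
  sum (map (h ∘ (ρ ∘_)) (allMaps (suc k) n)) ∎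
  where
  open ≡-Reasoning
  sumOutHead-∘ : ∀ f → sumOutHead h (ρ ∘ f) ≡ sumOutHead (h ∘ (ρ ∘_)) f
  sumOutHead-∘ f = begin
    ∑ (λ x → h (x ∷ᶠ ρ ∘ f))
      ≡⟨ ∑-bijective ρ-bij (λ x → h (x ∷ᶠ ρ ∘ f)) ⟨
    ∑ (λ x → h (ρ x ∷ᶠ ρ ∘ f))
      ≡⟨ sum-cong-≗ {x = λ x → h (ρ x ∷ᶠ ρ ∘ f)} {y = λ x → h (ρ ∘ (x ∷ᶠ f))}
           (λ x → h-ext λ { zero → refl ; (suc i) → refl }) ⟩
    ∑ (λ x → h (ρ ∘ (x ∷ᶠ f))) ∎

≤-sum-allMaps : ∀ k {n} (h : (Fin k → Fin n) → ℕ) → Extensional h →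
                ∀ f → h f ≤ sum (map h (allMaps k n))
≤-sum-allMaps zero    h h-ext f = ≤-trans (≤-reflexive (h-ext λ ())) (m≤m+n _ 0)
≤-sum-allMaps (suc k) {n} h h-ext f = begin
  h f
    ≡⟨ h-ext (λ { zero → refl ; (suc i) → refl }) ⟩
  h (f zero ∷ᶠ f ∘ suc)
    ≤⟨ ≤-∑ (λ x → h (x ∷ᶠ f ∘ suc)) (f zero) ⟩
  sumOutHead h (f ∘ suc)
    ≤⟨ ≤-sum-allMaps k (sumOutHead h) (sumOutHead-extensional h-ext) (f ∘ suc) ⟩
  sum (map (sumOutHead h) (allMaps k n))
    ≡⟨ sum-allMaps-suc h h-ext ⟨
  sum (map h (allMaps (suc k) n)) ∎
  where open ≤-Reasoning

indicator : Bool → ℕ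
indicator b = if b then 1 else 0

count-allMaps-∘-bijective : ∀ {k n} {ρ : Fin n → Fin n} → Bijective _≡_ _≡_ ρ →
  (p : (Fin k → Fin n) → Bool) → Extensional p →
  count p (allMaps k n) ≡ count (p ∘ (ρ ∘_)) (allMaps k n)
count-allMaps-∘-bijective {k} ρ-bij p p-ext =
  sum-allMaps-∘-bijective k ρ-bij (indicator ∘ p) (cong indicator ∘ p-ext)

count-allMaps-≢0 : ∀ {k n} (p : (Fin k → Fin n) → Bool) → Extensional p →
                   ∀ {f} → T (p f) → count p (allMaps k n) ≢ 0
count-allMaps-≢0 {k} {n} p p-ext {f} pf = m<n⇒n≢0
  (subst (λ b → indicator b ≤ count p (allMaps k n)) (Equivalence.to T-≡ pf)
    (≤-sum-allMaps k (indicator ∘ p) (cong indicator ∘ p-ext) f))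

count≢0⇒∃ : ∀ {A : Set} (p : A → Bool) xs → count p xs ≢ 0 → ∃ λ x → T (p x)
count≢0⇒∃ p []       c≢0 = contradiction refl c≢0
count≢0⇒∃ p (x ∷ xs) c≢0 with p x in px
... | true  = x , Equivalence.from T-≡ px
... | false = count≢0⇒∃ p xs c≢0

count-cong : ∀ {A : Set} {p q : A → Bool} → p ≗ q → ∀ xs → count p xs ≡ count q xs
count-cong p≗q = sum-map-cong (cong indicator ∘ p≗q)

allB⁺ : ∀ {k} {p : Fin k → Bool} → T (allB p) → ∀ i → T (p i)
allB⁺ {k} {p} all-p i = lookup (all⁺ p (allFin k) all-p) (∈-allFin i)

allB⁻ : ∀ {k} {p : Fin k → Bool} → (∀ i → T (p i)) → T (allB p)
allB⁻ {p = p} all-p = all⁻ p (tabulate⁺ all-p)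

allB-cong : ∀ {k} {p q : Fin k → Bool} → p ≗ q → allB p ≡ allB q
allB-cong {k} p≗q = cong and (map-cong p≗q (allFin k))

T-injective : ∀ {x y} → (T x → T y) → (T y → T x) → x ≡ y
T-injective {false} {false} _ _ = refl
T-injective {false} {true}  _ y⇒x = contradiction (y⇒x _) λ ()
T-injective {true}  {false} x⇒y _ = contradiction (x⇒y _) λ ()
T-injective {true}  {true}  _ _ = refl

allB-swap : ∀ {k} (f : Fin k → Fin k → Bool) →
            allB (λ i → allB (λ j → f i j)) ≡ allB (λ j → allB (λ i → f i j))
allB-swap f = T-injective
  (λ all-f → allB⁻ λ j → allB⁻ λ i → allB⁺ {p = f i} (allB⁺ all-f i) j)
  (λ all-f → allB⁻ λ i → allB⁻ λ j → allB⁺ {p = λ i → f i j} (allB⁺ all-f j) i)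

implication-elim : ∀ {x y} → T (not x ∨ y) → T x → T y
implication-elim {true} y _ = y

xnor⇒implication : ∀ x y → T (not (y xor x)) → T (not x ∨ y)
xnor⇒implication false _     _ = _
xnor⇒implication true  true  _ = _

isHom⁺ : ∀ {k n} (F : Digraph k) (G : Digraph n) {φ : Fin k → Fin n} →
         T (isHom F G φ) → ∀ i j → T (adj F i j) → T (adj G (φ i) (φ j))
isHom⁺ F G {φ} φ-hom i j =
  implication-elim (allB⁺ {p = λ j → not (adj F i j) ∨ adj G (φ i) (φ j)} (allB⁺ φ-hom i) j)

isIndEmb⇒isHom : ∀ {k n} (F : Digraph k) (G : Digraph n) {φ : Fin k → Fin n} →
                 T (isIndEmb F G φ) → T (isHom F G φ)
isIndEmb⇒isHom F G {φ} φ-emb = allB⁻ λ i → allB⁻ λ j →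
  xnor⇒implication (adj F i j) (adj G (φ i) (φ j))
    (allB⁺ {p = λ j → not (adj G (φ i) (φ j) xor adj F i j)}
      (allB⁺ (proj₂ (Equivalence.to T-∧ φ-emb)) i) j)

isHom-id : ∀ {n} (G : Digraph n) → T (isHom G G id)
isHom-id G = allB⁻ λ i → allB⁻ λ j → Equivalence.from T-≡ (∨-inverseˡ (adj G i j))

isIndEmb-id : ∀ {n} (G : Digraph n) → T (isIndEmb G G id)
isIndEmb-id {n} G = Equivalence.from T-∧
  ( (allB⁻ {n} λ i → allB⁻ {n} λ j → Equivalence.from T-≡ (∨-inverseʳ (does (i ≟ j))))
  , (allB⁻ λ i → allB⁻ λ j → Equivalence.from T-≡ (cong not (xor-same (adj G i j)))))

isHom-extensional : ∀ {k n} (F : Digraph k) (G : Digraph n) → Extensional (isHom F G)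
isHom-extensional F G φ≗ψ = allB-cong λ i → allB-cong λ j →
  cong₂ (λ a b → not (adj F i j) ∨ adj G a b) (φ≗ψ i) (φ≗ψ j)

isIndEmb-extensional : ∀ {k n} (F : Digraph k) (G : Digraph n) → Extensional (isIndEmb F G)
isIndEmb-extensional F G φ≗ψ = cong₂ _∧_
  (allB-cong λ i → allB-cong λ j →
    cong₂ (λ a b → does (i ≟ j) ∨ not (does (a ≟ b))) (φ≗ψ i) (φ≗ψ j))
  (allB-cong λ i → allB-cong λ j →
    cong₂ (λ a b → not (adj G a b xor adj F i j)) (φ≗ψ i) (φ≗ψ j))

ReversesEdges : ∀ {n} → Digraph n → (Fin n → Fin n) → Set
ReversesEdges G ρ = ∀ a b → adj G (ρ a) (ρ b) ≡ adj G b a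

does-≟-injective : ∀ {n} {ρ : Fin n → Fin n} → Injective _≡_ _≡_ ρ →
                   ∀ a b → does (ρ a ≟ ρ b) ≡ does (a ≟ b)
does-≟-injective {ρ = ρ} ρ-inj a b with a ≟ b
... | yes refl = dec-true (ρ a ≟ ρ a) refl
... | no a≢b   = dec-false (ρ a ≟ ρ b) (a≢b ∘ ρ-inj)

module _ {n} {G : Digraph n} {ρ : Fin n → Fin n} (ρ-rev : ReversesEdges G ρ) where

  isHom-∘-reversing : ∀ {k} (F : Digraph k) φ → isHom F G (ρ ∘ φ) ≡ isHom (converse F) G φ
  isHom-∘-reversing F φ = trans
    (allB-cong λ i → allB-cong λ j → cong (not (adj F i j) ∨_) (ρ-rev (φ i) (φ j)))
    (allB-swap λ i j → not (adj F i j) ∨ adj G (φ j) (φ i))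

  isIndEmb-∘-reversing : Injective _≡_ _≡_ ρ → ∀ {k} (F : Digraph k) φ →
                         isIndEmb F G (ρ ∘ φ) ≡ isIndEmb (converse F) G φ
  isIndEmb-∘-reversing ρ-inj F φ = cong₂ _∧_
    (allB-cong λ i → allB-cong λ j →
      cong (λ b → does (i ≟ j) ∨ not b) (does-≟-injective ρ-inj (φ i) (φ j)))
    (trans
      (allB-cong λ i → allB-cong λ j →
        cong (λ b → not (b xor adj F i j)) (ρ-rev (φ i) (φ j)))
      (allB-swap λ i j → not (adj G (φ j) (φ i) xor adj F i j)))

  hom-converse : Bijective _≡_ _≡_ ρ → ∀ {k} (F : Digraph k) → hom F G ≡ hom (converse F) G
  hom-converse ρ-bij {k} F = trans
    (count-allMaps-∘-bijective ρ-bij (isHom F G) (isHom-extensional F G))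
    (count-cong (isHom-∘-reversing F) (allMaps k n))

  ind-converse : Bijective _≡_ _≡_ ρ → ∀ {k} (F : Digraph k) → ind F G ≡ ind (converse F) G
  ind-converse ρ-bij {k} F = trans
    (count-allMaps-∘-bijective ρ-bij (isIndEmb F G) (isIndEmb-extensional F G))
    (count-cong (isIndEmb-∘-reversing (proj₁ ρ-bij) F) (allMaps k n))

hom-refl≢0 : ∀ {n} (G : Digraph n) → hom G G ≢ 0
hom-refl≢0 G = count-allMaps-≢0 (isHom G G) (isHom-extensional G G) (isHom-id G)

ind-refl≢0 : ∀ {n} (G : Digraph n) → ind G G ≢ 0
ind-refl≢0 G = count-allMaps-≢0 (isIndEmb G G) (isIndEmb-extensional G G) (isIndEmb-id G)

÷-cancelʳ : ∀ {a b} d .{{_ : NonZero d}} → a ÷ d ≡ b ÷ d → a ≡ b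
÷-cancelʳ {a} {b} (suc d) a/d≡b/d =
  *-cancelʳ-≡ a b (suc d) (normalize-injective-≃ a b (suc d) (suc d) a/d≡b/d)

n^n-nonZero : ∀ n → NonZero (n ^ n)
n^n-nonZero zero    = _
n^n-nonZero (suc n) = m^n≢0 (suc n) (suc n)

nPn-nonZero : ∀ n → NonZero (n P n)
nPn-nonZero n = subst NonZero (sym (nPn≡n! n)) (n !≢0)

x+y≡1⇒x≡1⊎y≡1 : ∀ x y → x + y ≡ 1 → x ≡ 1 ⊎ y ≡ 1
x+y≡1⇒x≡1⊎y≡1 zero       y x+y≡1 = inj₂ x+y≡1
x+y≡1⇒x≡1⊎y≡1 (suc zero) y _     = inj₁ refl

module _ {n} (G : Tournament n) where

  private
    G⃗ G⃗′ : Digraph n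
    G⃗  = toDigraph G
    G⃗′ = converse G⃗

  edge⇒≢ : ∀ {u v} → α G u v ≡ 1 → u ≢ v
  edge⇒≢ {u} uv refl = contradiction (trans (sym (diag G u)) uv) λ ()

  edge⇒reverse-non-edge : ∀ {u v} → α G u v ≡ 1 → α G v u ≡ 0
  edge⇒reverse-non-edge {u} {v} uv =
    suc-injective (trans (cong (_+ α G v u) (sym uv)) (anti G u v (edge⇒≢ uv)))

  edge-either : ∀ {i j} → i ≢ j → α G i j ≡ 1 ⊎ α G j i ≡ 1
  edge-either {i} {j} i≢j = x+y≡1⇒x≡1⊎y≡1 (α G i j) (α G j i) (anti G i j i≢j)

  α′-transpose : ∀ i j → α′ G i j ≡ α G j i
  α′-transpose i j with i ≟ j
  ... | yes refl = sym (diag G i)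
  ... | no i≢j   =
    trans (cong (_∸ α G i j) (sym (anti G i j i≢j))) (m+n∸m≡n (α G i j) (α G j i))

  Reverses : (Fin n → Fin n) → Set
  Reverses ρ = ∀ i j → α G (ρ i) (ρ j) ≡ α G j i

  Complements : (Fin n → Fin n) → Set
  Complements ρ = ∀ i j → i ≢ j → α G i j + α G (ρ i) (ρ j) ≡ 1

  AntiAutomorphic : Set
  AntiAutomorphic = Σ (Fin n → Fin n) λ ρ → Bijective _≡_ _≡_ ρ × Reverses ρ

  reverses⇒reversesEdges : ∀ {ρ} → Reverses ρ → ReversesEdges G⃗ ρ
  reverses⇒reversesEdges ρ-rev a b = cong (_≡ᵇ 1) (ρ-rev a b)

  selfConverse⇔antiAutomorphic : SelfConverse G ⇔ AntiAutomorphic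
  selfConverse⇔antiAutomorphic = mk⇔
    (λ (ρ , ρ-bij , iso) →
      ρ , ρ-bij , λ i j → sym (trans (iso j i) (α′-transpose (ρ j) (ρ i))))
    (λ (ρ , ρ-bij , ρ-rev) →
      ρ , ρ-bij , λ i j → sym (trans (α′-transpose (ρ i) (ρ j)) (ρ-rev j i)))

  reverses⇔complements : ∀ {ρ} → Reverses ρ ⇔ Complements ρ
  reverses⇔complements {ρ} = mk⇔
    (λ ρ-rev i j i≢j → trans (cong (α G i j +_) (ρ-rev i j)) (anti G i j i≢j))
    complements⇒reverses
    where
    complements⇒reverses : Complements ρ → Reverses ρ
    complements⇒reverses ρ-comp i j with i ≟ j
    ... | yes refl = trans (diag G (ρ i)) (sym (diag G i))
    ... | no i≢j   =
      +-cancelˡ-≡ (α G i j) _ _ (trans (ρ-comp i j i≢j) (sym (anti G i j i≢j)))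

  module _ {φ : Fin n → Fin n}
           (φ-maps-converse : ∀ i j → α G j i ≡ 1 → α G (φ i) (φ j) ≡ 1) where

    converseHom-injective : Injective _≡_ _≡_ φ
    converseHom-injective {i} {j} φi≡φj with i ≟ j
    ... | yes i≡j = i≡j
    ... | no i≢j with edge-either i≢j
    ...   | inj₁ ij = contradiction φi≡φj (edge⇒≢ (φ-maps-converse j i ij) ∘ sym)
    ...   | inj₂ ji = contradiction φi≡φj (edge⇒≢ (φ-maps-converse i j ji))

    converseHom-reverses : Reverses φ
    converseHom-reverses i j with i ≟ j
    ... | yes refl = trans (diag G (φ i)) (sym (diag G i))
    ... | no i≢j with edge-either i≢j
    ...   | inj₁ ij = trans (edge⇒reverse-non-edge (φ-maps-converse j i ij))
                            (sym (edge⇒reverse-non-edge ij))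
    ...   | inj₂ ji = trans (φ-maps-converse i j ji) (sym ji)

  converseHom⇒antiAutomorphic : ∀ {φ} → T (isHom G⃗′ G⃗ φ) → AntiAutomorphic
  converseHom⇒antiAutomorphic {φ} φ-hom =
    φ , injective⇒bijective (converseHom-injective maps-converse) , converseHom-reverses maps-converse
    where
    maps-converse : ∀ i j → α G j i ≡ 1 → α G (φ i) (φ j) ≡ 1
    maps-converse i j ji = ≡ᵇ⇒≡ _ 1 (isHom⁺ G⃗′ G⃗ φ-hom i j (≡⇒≡ᵇ _ 1 ji))

  antiAutomorphic⇔t-symmetric :
    AntiAutomorphic ⇔ (∀ k (F : Digraph k) → t F G⃗ ≡ t (converse F) G⃗)
  antiAutomorphic⇔t-symmetric = mk⇔
    (λ (ρ , ρ-bij , ρ-rev) k F →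
      cong (_÷ (n ^ k)) (hom-converse {G = G⃗} (reverses⇒reversesEdges ρ-rev) ρ-bij F))
    (λ t-sym → converseHom⇒antiAutomorphic (proj₂ (count≢0⇒∃ (isHom G⃗′ G⃗) (allMaps n n)
      (subst (_≢ 0) (÷-cancelʳ (n ^ n) {{n^n-nonZero n}} (t-sym n G⃗)) (hom-refl≢0 G⃗)))))

  antiAutomorphic⇔tind-symmetric : AntiAutomorphic ⇔
    (∀ k (F : Tournament k) → tind (toDigraph F) G⃗ ≡ tind (converse (toDigraph F)) G⃗)
  antiAutomorphic⇔tind-symmetric = mk⇔
    (λ (ρ , ρ-bij , ρ-rev) k F →
      cong (_÷ (n P k)) (ind-converse {G = G⃗} (reverses⇒reversesEdges ρ-rev) ρ-bij (toDigraph F)))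
    (λ tind-sym → converseHom⇒antiAutomorphic (isIndEmb⇒isHom G⃗′ G⃗
      (proj₂ (count≢0⇒∃ (isIndEmb G⃗′ G⃗) (allMaps n n)
        (subst (_≢ 0) (÷-cancelʳ (n P n) {{nPn-nonZero n}} (tind-sym n G)) (ind-refl≢0 G⃗))))))

  antiAutomorphic⇔complementing :
    AntiAutomorphic ⇔ Σ (Fin n → Fin n) (λ ρ → Bijective _≡_ _≡_ ρ × Complements ρ)
  antiAutomorphic⇔complementing = mk⇔
    (λ (ρ , ρ-bij , ρ-rev) → ρ , ρ-bij , Equivalence.to reverses⇔complements ρ-rev)
    (λ (ρ , ρ-bij , ρ-comp) → ρ , ρ-bij , Equivalence.from reverses⇔complements ρ-comp)

mainTheorem5 : (n : ℕ) (G : Tournament n) →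
    (SelfConverse G ⇔
      (∀ (k : ℕ) (F : Tournament k) →
        tind (toDigraph F) (toDigraph G) ≡ tind (converse (toDigraph F)) (toDigraph G)))
  × (SelfConverse G ⇔
      (∀ (k : ℕ) (F : Digraph k) → t F (toDigraph G) ≡ t (converse F) (toDigraph G)))
  × (SelfConverse G ⇔
      Σ (Fin n → Fin n) (λ ρ → Bijective _≡_ _≡_ ρ
        × (∀ i j → i ≢ j → α G i j + α G (ρ i) (ρ j) ≡ 1)))
mainTheorem5 n G =
    antiAutomorphic⇔tind-symmetric G ⇔-∘ selfConverse⇔antiAutomorphic G
  , antiAutomorphic⇔t-symmetric G ⇔-∘ selfConverse⇔antiAutomorphic G
  , antiAutomorphic⇔complementing G ⇔-∘ selfConverse⇔antiAutomorphic G
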